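{- Let $L_1\subseteq T^\omega_{\Sigma_1}$ and $L_2\subseteq T^\omega_{\Sigma_2}$ be regular tree languages and let $F:\Sigma_1^*\to\Sigma_2$ be a function definable by a Moore machine. Assume that for every $t\in T^\omega_{\Sigma_1}$, $t\in L_1$ iff $\widehat{F}(t)\in L_2$. Then $da(L_1)\le da(L_2)$.
   Context: A Moore machine is $M=(\Sigma,\Gamma,Q,q_I,\delta,out)$ with finite input alphabet $\Sigma$, finite state set $Q$, initial state $q_I$, transition function $\delta:Q\times\Sigma\to Q$, output alphabet $\Gamma$ and output function $out:Q\to\Gamma$; $\widehat\delta(\epsilon)=q_I$, $\widehat\delta(wa)=\delta(\widehat\delta(w),a)$. $F:\Sigma^*\to\Gamma$ is definable by a Moore machine if $F(w)=out(\widehat\delta(w))$ for some such $M$. For $t\in T^\omega_{\Sigma_1}$ (a tree $t:\{l,r\}^*\to\Sigma_1$), $\widehat F(t)\in T^\omega_{\Sigma_2}$ is defined by $\widehat F(t)(v)=F(t(v_1)\cdots t(v_k))$ where $v_1,\dots,v_k$ is the path from the root to $v$ (including $v$). A parity tree automaton (PTA) $\mathcal{A}=(Q,\Sigma,Q_I,\delta,\mathbb{C})$: computations $\phi:\{l,r\}^*\to Q$ with $\phi(\epsilon)\in Q_I$ and $(\phi(v),t(v),\phi(vl),\phi(vr))\in\delta$, accepting if along every branch the maximal color occurring infinitely often is even; $ACC(\mathcal{A},t)$ the set of accepting computations. Degree of ambiguity $da(\mathcal{A})$: $k$ if $|ACC(\mathcal{A},t)|\le k$ for all $t$ and ($k=1$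 or not $(k-1)$-bounded); "finite" if finitely but not boundedly ambiguous; $\aleph_0$ if countably but not finitely ambiguous; $2^{\aleph_0}$ if not countably ambiguous; ordered $1<2<\dots<\text{finite}<\aleph_0<2^{\aleph_0}$. For a regular language $L$, $da(L)=\min\{da(\mathcal{A}):L(\mathcal{A})=L\}$. -}

module Defs where

open import Data.Nat using (ℕ; zero; suc; _≤_; _+_; _*_)
open import Data.Fin using (Fin)
open import Data.Bool using (Bool; true)
open import Data.List using (List; []; _∷_; _++_; [_]; map; upTo; foldl)
open import Data.Vec using (Vec)
open import Data.Vec.Membership.Propositional using () renaming (_∈_ to _∈ᵥ_)
open import Data.Product using (Σ; ∃; ∃-syntax; _×_; _,_)
open import Data.Unit using (⊤)
open import Relation.Binary.PropositionalEquality using (_≡_; _≗_)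

data Dir : Set where
  l r : Dir

-- nodes are words over {l,r}, read from the root; the root is []
Node : Set
Node = List Dir

Tree : ℕ → Set
Tree n = Node → Fin n

record Moore (n₁ n₂ : ℕ) : Set where
  field
    nS   : ℕ
    qI   : Fin nS
    δ    : Fin nS → Fin n₁ → Fin nS
    out  : Fin nS → Fin n₂

δ̂ : ∀ {n₁ n₂} (M : Moore n₁ n₂) → List (Fin n₁) → Fin (Moore.nS M)
δ̂ M w = foldl (Moore.δ M) (Moore.qI M) w

MooreDefinable : ∀ {n₁ n₂} → (List (Fin n₁) → Fin n₂) → Set
MooreDefinable {n₁} {n₂} F =
  Σ (Moore n₁ n₂) λ M → ∀ (w : List (Fin n₁)) → F w ≡ Moore.out M (δ̂ M w)

-- labels t(v₁) ⋯ t(v_k) along the path from the root to v (root and v included)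
pathLabels : ∀ {n} → Tree n → Node → List (Fin n)
pathLabels t []      = t [] ∷ []
pathLabels t (d ∷ v) = t [] ∷ pathLabels (λ w → t (d ∷ w)) v

hat : ∀ {n₁ n₂} → (List (Fin n₁) → Fin n₂) → Tree n₁ → Tree n₂
hat F t v = F (pathLabels t v)

record PTA (n : ℕ) : Set where
  field
    nQ  : ℕ
    QI  : Fin nQ → Bool
    δ   : Fin nQ → Fin n → Fin nQ → Fin nQ → Bool
    col : Fin nQ → ℕ

Even : ℕ → Set
Even m = ∃[ k ] m ≡ k + k

MaxInfOftenEven : (ℕ → ℕ) → Set
MaxInfOftenEven c =
  ∃[ m ] Even m
       × (∃[ N ] ∀ i → N ≤ i → c i ≤ m)
       × (∀ i → ∃[ j ] (i ≤ j × c j ≡ m))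

prefix : (ℕ → Dir) → ℕ → Node
prefix π i = map π (upTo i)

module _ {n : ℕ} (A : PTA n) where
  open PTA A

  Computation : Set
  Computation = Node → Fin nQ

  IsComputation : Tree n → Computation → Set
  IsComputation t φ =
    QI (φ []) ≡ true
    × (∀ v → δ (φ v) (t v) (φ (v ++ [ l ])) (φ (v ++ [ r ])) ≡ true)

  IsAccepting : Computation → Set
  IsAccepting φ = ∀ (π : ℕ → Dir) → MaxInfOftenEven (λ i → col (φ (prefix π i)))

  ACC : Tree n → Computation → Set
  ACC t φ = IsComputation t φ × IsAccepting φ

  -- A covering of ACC(A,t) by a (finite / countable) family: every accepting
  -- computation is (pointwise) equal to a member of the family.
  CoveredByVec : ∀ {k} → Tree n → Vec Computation k → Set
  CoveredByVec t xs = ∀ φ → ACC t φ → ∃[ ψ ] (ψ ∈ᵥ xs × φ ≗ ψ)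

  CoveredBySeq : Tree n → (ℕ → Computation) → Set
  CoveredBySeq t f = ∀ φ → ACC t φ → ∃[ i ] (φ ≗ f i)

  Bounded : ℕ → Set
  Bounded k = ∀ t → Σ (Vec Computation k) (CoveredByVec t)

  FinitelyAmbiguous : Set
  FinitelyAmbiguous = ∀ t → ∃[ k ] Σ (Vec Computation k) (CoveredByVec t)

  CountablyAmbiguous : Set
  CountablyAmbiguous = ∀ t → ∃[ f ] CoveredBySeq t f

Lang : ∀ {n} → PTA n → Tree n → Set
Lang A t = ∃[ φ ] ACC A t φ

Recognizes : ∀ {n} → PTA n → (Tree n → Set) → Set
Recognizes A L = ∀ t → (L t → Lang A t) × (Lang A t → L t)

Regular : ∀ {n} → (Tree n → Set) → Set
Regular {n} L = Σ (PTA n) λ A → Recognizes A L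

data Degree : Set where
  bnd     : ℕ → Degree   -- bnd k  stands for the degree  suc k  (k+1 ≥ 1)
  finite  : Degree
  aleph0  : Degree
  contin  : Degree

DaAtMost : ∀ {n} → PTA n → Degree → Set
DaAtMost A (bnd k) = Bounded A (suc k)
DaAtMost A finite  = FinitelyAmbiguous A
DaAtMost A aleph0  = CountablyAmbiguous A
DaAtMost A contin  = ⊤

-- da(L) ≤ d, where da(L) = min { da(A) : L(A) = L }
DaLangAtMost : ∀ {n} → (Tree n → Set) → Degree → Set
DaLangAtMost {n} L d = Σ (PTA n) λ A → Recognizes A L × DaAtMost A d

-- da(L₁) ≤ da(L₂)   (the order on degrees is total)
DaLangLe : ∀ {n₁ n₂} → (Tree n₁ → Set) → (Tree n₂ → Set) → Set
DaLangLe L₁ L₂ = ∀ d → DaLangAtMost L₂ d → DaLangAtMost L₁ d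

-- Let A be a parity tree automaton for L₂ and M a Moore machine for F. On an input t, the product
-- automaton M × A guesses at every node v the state of M after the labels strictly above v, together
-- with a state of A that reads the letter F(t(v₁)⋯t(v)) which M outputs at v. Since M is
-- deterministic the first component is forced, so the accepting runs of M × A on t correspond
-- one-to-one to the accepting runs of A on F̂(t). Hence M × A recognises L₁ and is at most as
-- ambiguous as A.
module Submission where

open import Defs
open import Data.Nat using (ℕ; _*_; _≤_)
open import Data.Fin using (Fin; combine; quotient; remainder)
import Data.Fin as Fin
open import Data.Fin.Properties using (remQuot-combine; combine-remQuot)
open import Data.Bool using (true) renaming (_≟_ to _≟ᵇ_)
open import Data.List using (List; []; _∷_; _∷ʳ_; foldl)
open import Data.List.Reverse using (Reverse; []; _∶_∶ʳ_; reverseView)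
open import Data.Product using (_×_; _,_; proj₁; proj₂)
open import Data.Vec using (Vec; map)
open import Data.Vec.Membership.Propositional.Properties using (∈-map⁺)
open import Data.Unit using (tt)
open import Relation.Nullary using (Dec; yes; no; does)
open import Relation.Nullary.Decidable using (dec-true; _×-dec_)
open import Relation.Binary.PropositionalEquality
  using (_≡_; _≗_; refl; sym; trans; cong; cong₂; subst; module ≡-Reasoning)

does-true⇒ : ∀ {p} {P : Set p} (P? : Dec P) → does P? ≡ true → P
does-true⇒ (yes p) _  = p
does-true⇒ (no _)  ()

MaxInfOftenEven-cong : ∀ {c c′ : ℕ → ℕ} → c ≗ c′ → MaxInfOftenEven c → MaxInfOftenEven c′
MaxInfOftenEven-cong {c} {c′} c≗c′ (m , even , (N , bounded) , recurrent) =
  m , even , (N , λ i N≤i → subst (_≤ m) (c≗c′ i) (bounded i N≤i)) ,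
  λ i → let (j , i≤j , cj≡m) = recurrent i in j , i≤j , trans (sym (c≗c′ j)) cj≡m

record RunTransfer {n₁ n₂} (B : PTA n₁) (A : PTA n₂) (h : Tree n₁ → Tree n₂) : Set where
  field
    lift           : Tree n₁ → Computation A → Computation B
    project        : Computation B → Computation A
    lift-ACC       : ∀ t ψ → ACC A (h t) ψ → ACC B t (lift t ψ)
    project-ACC    : ∀ t φ → ACC B t φ → ACC A (h t) (project φ)
    ≗-lift-project : ∀ t φ → ACC B t φ → ∀ ψ → project φ ≗ ψ → φ ≗ lift t ψ

module _ {n₁ n₂} {B : PTA n₁} {A : PTA n₂} {h : Tree n₁ → Tree n₂} (T : RunTransfer B A h) where
  open RunTransfer T

  Lang-transfer : ∀ t → (Lang A (h t) → Lang B t) × (Lang B t → Lang A (h t))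
  Lang-transfer t = (λ (ψ , acc) → lift t ψ , lift-ACC t ψ acc)
                  , (λ (φ , acc) → project φ , project-ACC t φ acc)

  Recognizes-transfer : ∀ {L₁ : Tree n₁ → Set} {L₂ : Tree n₂ → Set}
    → (∀ t → (L₁ t → L₂ (h t)) × (L₂ (h t) → L₁ t))
    → Recognizes A L₂ → Recognizes B L₁
  Recognizes-transfer L₁⇔L₂ A-rec t =
      (λ x → proj₁ (Lang-transfer t) (proj₁ (A-rec (h t)) (proj₁ (L₁⇔L₂ t) x)))
    , (λ x → proj₂ (L₁⇔L₂ t) (proj₂ (A-rec (h t)) (proj₂ (Lang-transfer t) x)))

  CoveredByVec-transfer : ∀ {k} t {xs : Vec (Computation A) k}
    → CoveredByVec A (h t) xs → CoveredByVec B t (map (lift t) xs)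
  CoveredByVec-transfer t cover φ acc =
    let (ψ , ψ∈xs , projφ≗ψ) = cover (project φ) (project-ACC t φ acc)
    in lift t ψ , ∈-map⁺ (lift t) ψ∈xs , ≗-lift-project t φ acc ψ projφ≗ψ

  CoveredBySeq-transfer : ∀ t {f : ℕ → Computation A}
    → CoveredBySeq A (h t) f → CoveredBySeq B t (λ i → lift t (f i))
  CoveredBySeq-transfer t {f} cover φ acc =
    let (i , projφ≗fi) = cover (project φ) (project-ACC t φ acc)
    in i , ≗-lift-project t φ acc (f i) projφ≗fi

  DaAtMost-transfer : ∀ d → DaAtMost A d → DaAtMost B d
  DaAtMost-transfer (bnd k) bounded t =
    let (xs , cover) = bounded (h t) in map (lift t) xs , CoveredByVec-transfer t cover
  DaAtMost-transfer finite finitely t =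
    let (k , xs , cover) = finitely (h t) in k , map (lift t) xs , CoveredByVec-transfer t cover
  DaAtMost-transfer aleph0 countably t =
    let (f , cover) = countably (h t) in (λ i → lift t (f i)) , CoveredBySeq-transfer t cover
  DaAtMost-transfer contin _ = tt

module MooreRun {n₁ n₂} (M : Moore n₁ n₂) where
  open Moore M

  -- the state of M after reading, from s, the labels strictly above the node
  runAbove : Fin nS → Tree n₁ → Node → Fin nS
  runAbove s t []      = s
  runAbove s t (d ∷ v) = runAbove (δ s (t [])) (λ w → t (d ∷ w)) v

  runAbove-∷ʳ : ∀ s t v d → runAbove s t (v ∷ʳ d) ≡ δ (runAbove s t v) (t v)
  runAbove-∷ʳ s t []      d = refl
  runAbove-∷ʳ s t (_ ∷ v) d = runAbove-∷ʳ _ _ v d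

  foldl-pathLabels : ∀ s t v → foldl δ s (pathLabels t v) ≡ δ (runAbove s t v) (t v)
  foldl-pathLabels s t []      = refl
  foldl-pathLabels s t (_ ∷ v) = foldl-pathLabels _ _ v

module MooreProduct {n₁ n₂} (M : Moore n₁ n₂) (A : PTA n₂) where
  open Moore M
  open MooreRun M
  module A = PTA A

  moorePart : Fin (nS * A.nQ) → Fin nS
  moorePart = quotient {nS} A.nQ

  ptaPart : Fin (nS * A.nQ) → Fin A.nQ
  ptaPart = remainder {nS} A.nQ

  moorePart-combine : ∀ s q → moorePart (combine s q) ≡ s
  moorePart-combine s q = cong proj₁ (remQuot-combine {nS} {A.nQ} s q)

  ptaPart-combine : ∀ s q → ptaPart (combine s q) ≡ q
  ptaPart-combine s q = cong proj₂ (remQuot-combine {nS} {A.nQ} s q)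

  Initial : Fin (nS * A.nQ) → Set
  Initial k = moorePart k ≡ qI × A.QI (ptaPart k) ≡ true

  Step : Fin (nS * A.nQ) → Fin n₁ → Fin (nS * A.nQ) → Fin (nS * A.nQ) → Set
  Step k a k₁ k₂ = moorePart k₁ ≡ s′ × moorePart k₂ ≡ s′
                 × A.δ (ptaPart k) (out s′) (ptaPart k₁) (ptaPart k₂) ≡ true
    where s′ = δ (moorePart k) a

  initial? : ∀ k → Dec (Initial k)
  initial? k = (moorePart k Fin.≟ qI) ×-dec (A.QI (ptaPart k) ≟ᵇ true)

  step? : ∀ k a k₁ k₂ → Dec (Step k a k₁ k₂)
  step? k a k₁ k₂ = (moorePart k₁ Fin.≟ s′) ×-dec (moorePart k₂ Fin.≟ s′)
                  ×-dec (A.δ (ptaPart k) (out s′) (ptaPart k₁) (ptaPart k₂) ≟ᵇ true)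
    where s′ = δ (moorePart k) a

  initial-combine : ∀ {q} → A.QI q ≡ true → Initial (combine qI q)
  initial-combine {q} q-init rewrite moorePart-combine qI q | ptaPart-combine qI q = refl , q-init

  step-combine : ∀ {s q a s₁ q₁ s₂ q₂} → s₁ ≡ δ s a → s₂ ≡ δ s a
    → A.δ q (out (δ s a)) q₁ q₂ ≡ true → Step (combine s q) a (combine s₁ q₁) (combine s₂ q₂)
  step-combine {s} {q} {_} {s₁} {q₁} {s₂} {q₂} s₁≡ s₂≡ q-step
    rewrite moorePart-combine s q | ptaPart-combine s q
          | moorePart-combine s₁ q₁ | ptaPart-combine s₁ q₁
          | moorePart-combine s₂ q₂ | ptaPart-combine s₂ q₂ = s₁≡ , s₂≡ , q-step

  product : PTA n₁
  product = record
    { nQ  = nS * A.nQ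
    ; QI  = λ k → does (initial? k)
    ; δ   = λ k a k₁ k₂ → does (step? k a k₁ k₂)
    ; col = λ k → A.col (ptaPart k)
    }

  module _ (t : Tree n₁) (φ : Computation product) (φ-comp : IsComputation product t φ) where

    initial : Initial (φ [])
    initial = does-true⇒ (initial? (φ [])) (proj₁ φ-comp)

    step : ∀ v → Step (φ v) (t v) (φ (v ∷ʳ l)) (φ (v ∷ʳ r))
    step v = does-true⇒ (step? _ _ _ _) (proj₂ φ-comp v)

    moorePart-child : ∀ v d → moorePart (φ (v ∷ʳ d)) ≡ δ (moorePart (φ v)) (t v)
    moorePart-child v l = proj₁ (step v)
    moorePart-child v r = proj₁ (proj₂ (step v))

    moorePart-runAbove : ∀ {v} → Reverse v → moorePart (φ v) ≡ runAbove qI t v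
    moorePart-runAbove []            = proj₁ initial
    moorePart-runAbove (v ∶ rv ∶ʳ d) = begin
      moorePart (φ (v ∷ʳ d))        ≡⟨ moorePart-child v d ⟩
      δ (moorePart (φ v)) (t v)     ≡⟨ cong (λ s → δ s (t v)) (moorePart-runAbove rv) ⟩
      δ (runAbove qI t v) (t v)     ≡⟨ runAbove-∷ʳ qI t v d ⟨
      runAbove qI t (v ∷ʳ d)        ∎
      where open ≡-Reasoning

  module _ (F : List (Fin n₁) → Fin n₂) (F≡ : ∀ w → F w ≡ out (δ̂ M w)) where

    hat-runAbove : ∀ t v → hat F t v ≡ out (δ (runAbove qI t v) (t v))
    hat-runAbove t v = trans (F≡ (pathLabels t v)) (cong out (foldl-pathLabels qI t v))

    lift : Tree n₁ → Computation A → Computation product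
    lift t ψ v = combine (runAbove qI t v) (ψ v)

    lift-ACC : ∀ t ψ → ACC A (hat F t) ψ → ACC product t (lift t ψ)
    lift-ACC t ψ ((ψ-init , ψ-step) , ψ-acc) = (init , step′) , acc
      where
      init : PTA.QI product (lift t ψ []) ≡ true
      init = dec-true (initial? (lift t ψ [])) (initial-combine ψ-init)

      step′ : ∀ v → PTA.δ product (lift t ψ v) (t v) (lift t ψ (v ∷ʳ l)) (lift t ψ (v ∷ʳ r)) ≡ true
      step′ v = dec-true (step? (lift t ψ v) (t v) (lift t ψ (v ∷ʳ l)) (lift t ψ (v ∷ʳ r)))
        (step-combine (runAbove-∷ʳ qI t v l) (runAbove-∷ʳ qI t v r)
          (subst (λ a → A.δ (ψ v) a (ψ (v ∷ʳ l)) (ψ (v ∷ʳ r)) ≡ true) (hat-runAbove t v) (ψ-step v)))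

      acc : IsAccepting product (lift t ψ)
      acc π = MaxInfOftenEven-cong
        (λ i → cong A.col (sym (ptaPart-combine (runAbove qI t (prefix π i)) (ψ (prefix π i)))))
        (ψ-acc π)

    project : Computation product → Computation A
    project φ v = ptaPart (φ v)

    project-ACC : ∀ t φ → ACC product t φ → ACC A (hat F t) (project φ)
    project-ACC t φ (φ-comp , φ-acc) = (proj₂ (initial t φ φ-comp) , step′) , φ-acc
      where
      step′ : ∀ v → A.δ (project φ v) (hat F t v) (project φ (v ∷ʳ l)) (project φ (v ∷ʳ r)) ≡ true
      step′ v = subst (λ a → A.δ (project φ v) a (project φ (v ∷ʳ l)) (project φ (v ∷ʳ r)) ≡ true)
        (trans (cong (λ s → out (δ s (t v))) (moorePart-runAbove t φ φ-comp (reverseView v)))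
               (sym (hat-runAbove t v)))
        (proj₂ (proj₂ (step t φ φ-comp v)))

    ≗-lift-project : ∀ t φ → ACC product t φ → ∀ ψ → project φ ≗ ψ → φ ≗ lift t ψ
    ≗-lift-project t φ (φ-comp , _) ψ projφ≗ψ v = trans (sym (combine-remQuot {nS} A.nQ (φ v)))
      (cong₂ combine (moorePart-runAbove t φ φ-comp (reverseView v)) (projφ≗ψ v))

    runTransfer : RunTransfer product A (hat F)
    runTransfer = record
      { lift = lift ; project = project ; lift-ACC = lift-ACC
      ; project-ACC = project-ACC ; ≗-lift-project = ≗-lift-project }

lemma3p10 : ∀ {n₁ n₂ : ℕ} (L₁ : Tree n₁ → Set) (L₂ : Tree n₂ → Set)
    → Regular L₁ → Regular L₂
    → (F : List (Fin n₁) → Fin n₂) → MooreDefinable F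
    → (∀ (t : Tree n₁) → (L₁ t → L₂ (hat F t)) × (L₂ (hat F t) → L₁ t))
    → DaLangLe L₁ L₂
lemma3p10 L₁ L₂ _ _ F (M , F≡) L₁⇔L₂ d (A , A-rec , A-da) =
  product , Recognizes-transfer transfer L₁⇔L₂ A-rec , DaAtMost-transfer transfer d A-da
  where
  open MooreProduct M A
  transfer : RunTransfer product A (hat F)
  transfer = runTransfer F F≡
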